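{- Let $n>k\geq 1$ be integers and let $\mathcal{P}\in\{\mathcal{A}_{k+1},\mathcal{V}_{k+1},\Lambda_{k+1},\mathcal{D}_{k+1}\}$. Then $\mathrm{sat}^*(n,\mathcal{P})\leq k(n-1)+2$.
   Context: $\mathcal{A}_{k+1}$ is the antichain on $k+1$ elements; $\mathcal{V}_{k+1}$ is a single element below $k+1$ pairwise incomparable elements; $\Lambda_{k+1}$ is $k+1$ pairwise incomparable elements all below a single element; $\mathcal{D}_{k+1}$ is $k+1$ pairwise incomparable elements all above a single bottom element and all below a single top element. $\mathcal{B}_n$ is the Boolean lattice $(2^{[n]},\subseteq)$. A poset $\mathcal{P}'=(P',\le')$ is an induced subposet of $\mathcal{P}=(P,\le)$ if there is an injection $f:P'\to P$ with $u\le' v$ iff $f(u)\le f(v)$. A family $\mathcal{F}\subseteq 2^{[n]}$ (ordered by inclusion) is induced-$\mathcal{P}$-saturated in $\mathcal{B}_n$ if it contains no induced copy of $\mathcal{P}$, but every $\mathcal{F}'$ with $\mathcal{F}\subsetneq\mathcal{F}'\subseteq 2^{[n]}$ contains an induced copy of $\mathcal{P}$. $\mathrm{sat}^*(n,\mathcal{P})$ is the minimum size of an induced-$\mathcal{P}$-saturated family in $\mathcal{B}_n$. -}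

module Defs where

open import Data.Nat using (ℕ; zero; suc; _+_)
open import Data.Bool using (Bool; true; false; if_then_else_)
open import Data.Fin using (Fin)
open import Data.Fin.Subset using (Subset; _⊆_)
open import Data.Vec using ([]; _∷_)
open import Data.Maybe using (Maybe; just; nothing)
open import Data.Product using (Σ; _×_)
open import Data.Empty using (⊥)
open import Data.Unit using (⊤)
open import Function.Definitions using (Injective)
open import Function.Bundles using (_⇔_)
open import Relation.Binary.PropositionalEquality using (_≡_)
open import Relation.Nullary using (¬_)

record Poset : Set₁ where
  field
    Carrier : Set
    _≤P_    : Carrier → Carrier → Set

antichainRel : ∀ k → Fin (suc k) → Fin (suc k) → Set
antichainRel k i j = i ≡ j

𝒜 : ℕ → Poset   -- 𝒜 k is A_{k+1}
𝒜 k = record { Carrier = Fin (suc k) ; _≤P_ = antichainRel k }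

-- V_{k+1}: nothing is the bottom element, just i are k+1 incomparable elements.
vRel : ∀ k → Maybe (Fin (suc k)) → Maybe (Fin (suc k)) → Set
vRel k nothing  _        = ⊤
vRel k (just i) nothing  = ⊥
vRel k (just i) (just j) = i ≡ j

𝒱 : ℕ → Poset
𝒱 k = record { Carrier = Maybe (Fin (suc k)) ; _≤P_ = vRel k }

-- Λ_{k+1}: nothing is the top element.
λRel : ∀ k → Maybe (Fin (suc k)) → Maybe (Fin (suc k)) → Set
λRel k _        nothing  = ⊤
λRel k nothing  (just j) = ⊥
λRel k (just i) (just j) = i ≡ j

Λ : ℕ → Poset
Λ k = record { Carrier = Maybe (Fin (suc k)) ; _≤P_ = λRel k }

data DPt (k : ℕ) : Set where
  bot : DPt k
  top : DPt k
  mid : Fin (suc k) → DPt k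

dRel : ∀ k → DPt k → DPt k → Set
dRel k bot     _       = ⊤
dRel k top     bot     = ⊥
dRel k top     top     = ⊤
dRel k top     (mid j) = ⊥
dRel k (mid i) bot     = ⊥
dRel k (mid i) top     = ⊤
dRel k (mid i) (mid j) = i ≡ j

𝒟 : ℕ → Poset
𝒟 k = record { Carrier = DPt k ; _≤P_ = dRel k }

-- A family of subsets of [n], i.e. a subset of B_n, given by its indicator.
Family : ℕ → Set
Family n = Subset n → Bool

_∈F_ : ∀ {n} → Subset n → Family n → Set
s ∈F F = F s ≡ true

size : ∀ {n} → Family n → ℕ
size {zero}  F = if F [] then 1 else 0
size {suc n} F = size (λ s → F (false ∷ s)) + size (λ s → F (true ∷ s))

HasInducedCopy : ∀ {n} → Poset → Family n → Set
HasInducedCopy {n} P F =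
  Σ (Carrier → Subset n) λ f →
    Injective _≡_ _≡_ f ×
    (∀ u → f u ∈F F) ×
    (∀ u v → (u ≤P v) ⇔ (f u ⊆ f v))
  where open Poset P

InducedSaturated : ∀ {n} → Poset → Family n → Set
InducedSaturated {n} P F =
  ¬ HasInducedCopy P F ×
  (∀ (F′ : Family n) →
     (∀ s → s ∈F F → s ∈F F′) →
     Σ (Subset n) (λ s → s ∈F F′ × ¬ (s ∈F F)) →
     HasInducedCopy P F′)

-- Let F consist of ∅, [n] and, for each of k starting points i < k, the cyclic
-- intervals {i, …, i+m−1} (mod n) with 0 < m < n.  Each starting point gives a
-- maximal chain, so F is a union of k chains, has at most k(n−1)+2 members and
-- contains no antichain of k+1 sets, hence no induced A_{k+1}, V_{k+1}, Λ_{k+1},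
-- D_{k+1}.  Since k < n, the k intervals of a fixed length m are distinct; so a
-- new set s with |s| = m ∉ {0, n} forms, together with them, an antichain of
-- k+1 sets of equal size, which ∅ and [n] extend to each of the four posets.

module Submission where

open import Defs
open import Data.Nat using (ℕ; zero; suc; _+_; _*_; _∸_; _⊓_; _≤_; _<_; z≤n; s≤s; s≤s⁻¹)
open import Data.Nat.Properties
open import Data.Bool using (Bool; true; false)
import Data.Bool as Bool
open import Data.Fin using (Fin; zero; suc; toℕ; fromℕ<)
open import Data.Fin.Properties using (toℕ-fromℕ<; toℕ-injective; pigeonhole)
import Data.Fin.Properties as Fin
open import Data.Fin.Subset using (Subset; _⊆_; _∈_; _∉_; _∪_; ∣_∣; ⊥; ⊤; inside; outside)
open import Data.Fin.Subset.Properties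
  using (∣⊥∣≡0; ∣⊤∣≡n; ∣p∣≤n; ∣p∣≡n⇒p≡⊤; ⊥⊆; ⊆⊤; ⊆-refl; ⊆-reflexive; drop-∷-⊆; ∪⇔⊎; p⊆q⇒∣p∣≤∣q∣)
open import Data.Vec using ([]; _∷_; here; there)
open import Data.Vec.Properties using (≡-dec)
open import Data.List using (List; []; _∷_; length; map; _++_; allFin; applyUpTo; cartesianProductWith)
open import Data.List.Properties using (length-++; length-map; length-tabulate; length-applyUpTo)
open import Data.List.Relation.Unary.Any using (here; there; any?)
open import Data.List.Membership.Propositional using () renaming (_∈_ to _∈ₗ_)
open import Data.List.Membership.Propositional.Properties
  using (∈-cartesianProductWith⁺; ∈-cartesianProductWith⁻; ∈-allFin; ∈-applyUpTo⁺)
open import Data.Maybe using (Maybe; just; nothing)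
open import Data.Maybe.Properties using (just-injective)
open import Data.Product using (Σ; _×_; _,_; proj₁; proj₂)
open import Data.Sum using (_⊎_; inj₁; inj₂)
import Data.Sum as Sum
open import Data.Unit using (tt)
open import Function using (_∘_; id)
open import Function.Bundles using (_⇔_; mk⇔; Equivalence)
open import Function.Construct.Composition using (_⇔-∘_)
open import Function.Definitions using (Injective)
open import Relation.Binary using (tri<; tri≈; tri>)
open import Relation.Binary.Definitions using (Antisymmetric)
open import Relation.Binary.PropositionalEquality
  using (_≡_; _≢_; refl; sym; trans; cong; cong₂; subst; subst₂; module ≡-Reasoning)
open import Relation.Nullary using (¬_; contradiction)
open import Relation.Nullary.Decidable using (does; yes; no; dec-true)

⊆∧∣≡∣⇒≡ : ∀ {n} {p q : Subset n} → p ⊆ q → ∣ p ∣ ≡ ∣ q ∣ → p ≡ q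
⊆∧∣≡∣⇒≡ {p = []}          {[]}          _   _ = refl
⊆∧∣≡∣⇒≡ {p = outside ∷ p} {outside ∷ q} p⊆q e = cong (outside ∷_) (⊆∧∣≡∣⇒≡ (drop-∷-⊆ p⊆q) e)
⊆∧∣≡∣⇒≡ {p = outside ∷ p} {inside  ∷ q} p⊆q e =
  contradiction e (<⇒≢ (s≤s (p⊆q⇒∣p∣≤∣q∣ (drop-∷-⊆ p⊆q))))
⊆∧∣≡∣⇒≡ {p = inside  ∷ p} {outside ∷ q} p⊆q e = contradiction (p⊆q here) λ ()
⊆∧∣≡∣⇒≡ {p = inside  ∷ p} {inside  ∷ q} p⊆q e = cong (inside ∷_) (⊆∧∣≡∣⇒≡ (drop-∷-⊆ p⊆q) (suc-injective e))

∣p∣≡0⇒p≡⊥ : ∀ {n} {p : Subset n} → ∣ p ∣ ≡ 0 → p ≡ ⊥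
∣p∣≡0⇒p≡⊥ {n} e = sym (⊆∧∣≡∣⇒≡ ⊥⊆ (trans (∣⊥∣≡0 n) (sym e)))

Disjoint : ∀ {n} → Subset n → Subset n → Set
Disjoint p q = ∀ {x} → x ∈ p → x ∉ q

drop-∷-Disjoint : ∀ {n} {s t} {p q : Subset n} → Disjoint (s ∷ p) (t ∷ q) → Disjoint p q
drop-∷-Disjoint disjoint x∈p x∈q = disjoint (there x∈p) (there x∈q)

∣p∪q∣≡∣p∣+∣q∣ : ∀ {n} (p q : Subset n) → Disjoint p q → ∣ p ∪ q ∣ ≡ ∣ p ∣ + ∣ q ∣
∣p∪q∣≡∣p∣+∣q∣ []            []            _ = refl
∣p∪q∣≡∣p∣+∣q∣ (outside ∷ p) (outside ∷ q) d = ∣p∪q∣≡∣p∣+∣q∣ p q (drop-∷-Disjoint d)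
∣p∪q∣≡∣p∣+∣q∣ (outside ∷ p) (inside  ∷ q) d =
  trans (cong suc (∣p∪q∣≡∣p∣+∣q∣ p q (drop-∷-Disjoint d))) (sym (+-suc ∣ p ∣ ∣ q ∣))
∣p∪q∣≡∣p∣+∣q∣ (inside  ∷ p) (outside ∷ q) d = cong suc (∣p∪q∣≡∣p∣+∣q∣ p q (drop-∷-Disjoint d))
∣p∪q∣≡∣p∣+∣q∣ (inside  ∷ p) (inside  ∷ q) d = contradiction here (d here)

segment : ∀ {n} → ℕ → ℕ → Subset n
segment {zero}  _       _       = []
segment {suc n} zero    zero    = outside ∷ segment 0 0
segment {suc n} zero    (suc b) = inside  ∷ segment 0 b
segment {suc n} (suc a) zero    = outside ∷ segment a 0
segment {suc n} (suc a) (suc b) = outside ∷ segment a b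

∈segment⁻ : ∀ {n} {a b} {x : Fin n} → x ∈ segment a b → a ≤ toℕ x × toℕ x < b
∈segment⁻ {suc n} {zero}  {suc b} {zero} here = z≤n , s≤s z≤n
∈segment⁻ {suc n} {zero}  {zero}  {suc x} (there p) with () ← ∈segment⁻ p
∈segment⁻ {suc n} {zero}  {suc b} {suc x} (there p) with _ , x<b ← ∈segment⁻ p = z≤n , s≤s x<b
∈segment⁻ {suc n} {suc a} {zero}  {suc x} (there p) with _ , () ← ∈segment⁻ p
∈segment⁻ {suc n} {suc a} {suc b} {suc x} (there p) with a≤x , x<b ← ∈segment⁻ p = s≤s a≤x , s≤s x<b

∈segment⁺ : ∀ {n} {a b} {x : Fin n} → a ≤ toℕ x → toℕ x < b → x ∈ segment a b
∈segment⁺ {suc n} {zero}  {suc b} {zero}  _         _         = here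
∈segment⁺ {suc n} {zero}  {suc b} {suc x} _         (s≤s x<b) = there (∈segment⁺ z≤n x<b)
∈segment⁺ {suc n} {suc a} {suc b} {suc x} (s≤s a≤x) (s≤s x<b) = there (∈segment⁺ a≤x x<b)

∣segment∣ : ∀ {n} a b → ∣ segment {n} a b ∣ ≡ b ⊓ n ∸ a
∣segment∣ {zero}  a       b       = sym (trans (cong (_∸ a) (⊓-zeroʳ b)) (0∸n≡0 a))
∣segment∣ {suc n} zero    zero    = ∣segment∣ {n} 0 0
∣segment∣ {suc n} zero    (suc b) = cong suc (∣segment∣ 0 b)
∣segment∣ {suc n} (suc a) zero    = trans (∣segment∣ {n} a 0) (0∸n≡0 a)
∣segment∣ {suc n} (suc a) (suc b) = ∣segment∣ a b

-- x ∈ {i, i+1, …, i+m−1} taken modulo n (for i < n, m ≤ n): the part below n,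
-- and the part {0, …, i+m−n−1} that wraps around.
OnArc : ℕ → ℕ → ℕ → ℕ → Set
OnArc n i m x = (i ≤ x × x < i + m) ⊎ x < i + m ∸ n

arc : ∀ {n} → ℕ → ℕ → Subset n
arc {n} i m = segment i (i + m) ∪ segment 0 (i + m ∸ n)

∈arc⇔ : ∀ {n} {i m} {x : Fin n} → x ∈ arc i m ⇔ OnArc n i m (toℕ x)
∈arc⇔ {i = i} {m} = mk⇔
  (Sum.map ∈segment⁻ (proj₂ ∘ ∈segment⁻) ∘ Equivalence.to (∪⇔⊎ {p = segment i (i + m)}))
  (Equivalence.from ∪⇔⊎ ∘ Sum.map (λ (i≤x , x<i+m) → ∈segment⁺ i≤x x<i+m) (∈segment⁺ z≤n))

∈arc-fromℕ< : ∀ {n} {i m x} (x<n : x < n) → fromℕ< x<n ∈ arc i m ⇔ OnArc n i m x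
∈arc-fromℕ< {n} {i} {m} x<n =
  subst (λ y → fromℕ< x<n ∈ arc i m ⇔ OnArc n i m y) (toℕ-fromℕ< x<n) ∈arc⇔

wrap≤start : ∀ {n} i {m} → m ≤ n → i + m ∸ n ≤ i
wrap≤start {n} i {m} m≤n =
  m≤n+o⇒m∸n≤o (i + m) n (≤-trans (+-monoʳ-≤ i m≤n) (≤-reflexive (+-comm i n)))

arc-mono : ∀ {n} i {m m′} → m ≤ m′ → arc {n} i m ⊆ arc i m′
arc-mono {n} i {m} {m′} m≤m′ = Equivalence.from ∈arc⇔ ∘ Sum.map widen shorten ∘ Equivalence.to ∈arc⇔
  where
  widen : ∀ {x} → i ≤ x × x < i + m → i ≤ x × x < i + m′
  widen (i≤x , x<i+m) = i≤x , <-≤-trans x<i+m (+-monoʳ-≤ i m≤m′)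
  shorten : ∀ {x} → x < i + m ∸ n → x < i + m′ ∸ n
  shorten x<w = <-≤-trans x<w (∸-monoˡ-≤ n (+-monoʳ-≤ i m≤m′))

∣arc∣ : ∀ {n} i m → i ≤ n → m ≤ n → ∣ arc {n} i m ∣ ≡ m
∣arc∣ {n} i m i≤n m≤n = begin
  ∣ arc {n} i m ∣
    ≡⟨ ∣p∪q∣≡∣p∣+∣q∣ _ _ disjoint ⟩
  ∣ segment {n} i (i + m) ∣ + ∣ segment {n} 0 (i + m ∸ n) ∣
    ≡⟨ cong₂ _+_ (∣segment∣ i (i + m)) (∣segment∣ 0 (i + m ∸ n)) ⟩
  (i + m) ⊓ n ∸ i + (i + m ∸ n) ⊓ n
    ≡⟨ cong ((i + m) ⊓ n ∸ i +_) (m≤n⇒m⊓n≡m (≤-trans (wrap≤start i m≤n) i≤n)) ⟩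
  (i + m) ⊓ n ∸ i + (i + m ∸ n)
    ≡⟨ split (≤-total (i + m) n) ⟩
  m ∎
  where
  open ≡-Reasoning
  disjoint : Disjoint (segment {n} i (i + m)) (segment 0 (i + m ∸ n))
  disjoint x∈p x∈q = <⇒≱ (<-≤-trans (proj₂ (∈segment⁻ x∈q)) (wrap≤start i m≤n)) (proj₁ (∈segment⁻ x∈p))
  split : i + m ≤ n ⊎ n ≤ i + m → (i + m) ⊓ n ∸ i + (i + m ∸ n) ≡ m
  split (inj₁ i+m≤n) rewrite m≤n⇒m⊓n≡m i+m≤n | m≤n⇒m∸n≡0 i+m≤n = trans (+-identityʳ _) (m+n∸m≡n i m)
  split (inj₂ n≤i+m) rewrite m≥n⇒m⊓n≡n n≤i+m = begin
    n ∸ i + (i + m ∸ n)     ≡⟨ sym (+-∸-assoc (n ∸ i) n≤i+m) ⟩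
    n ∸ i + (i + m) ∸ n     ≡⟨ cong (_∸ n) (sym (+-assoc (n ∸ i) i m)) ⟩
    n ∸ i + i + m ∸ n       ≡⟨ cong (λ y → y + m ∸ n) (m∸n+n≡m i≤n) ⟩
    n + m ∸ n               ≡⟨ m+n∸m≡n n m ⟩
    m                       ∎

arc-empty : ∀ {n} i → i ≤ n → arc {n} i 0 ≡ ⊥
arc-empty i i≤n = ∣p∣≡0⇒p≡⊥ (∣arc∣ i 0 i≤n z≤n)

arc-full : ∀ {n} i → i ≤ n → arc {n} i n ≡ ⊤
arc-full i i≤n = ∣p∣≡n⇒p≡⊤ (∣arc∣ i _ i≤n ≤-refl)

arc-distinct : ∀ {n i j m} → i < j → j < n → 0 < m → m < n → arc {n} i m ≢ arc j m
-- j is on arc j m, hence on arc i m without wrapping, so j−1 is on arc i m = arc j m,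
-- which is only possible if arc j m wraps all the way round, i.e. m ≥ n.
arc-distinct {n} {i} {suc j} {m} i<j j<n 0<m m<n eq =
  j-not-on-arc (along (sym eq) j<n (inj₁ (≤-refl , m<m+n (suc j) 0<m)))
  where
  along : ∀ {a b x} → arc {n} a m ≡ arc b m → (x<n : x < n) → OnArc n a m x → OnArc n b m x
  along e x<n =
    Equivalence.to (∈arc-fromℕ< x<n) ∘ subst (fromℕ< x<n ∈_) e ∘ Equivalence.from (∈arc-fromℕ< x<n)

  pred-not-on-arc : ¬ OnArc n (suc j) m j
  pred-not-on-arc (inj₁ (j+1≤j , _)) = <-irrefl refl j+1≤j
  pred-not-on-arc (inj₂ j<wrap) = <-irrefl refl (<-≤-trans j<wrap (m≤n+o⇒m∸n≤o (suc j + m) n (begin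
    suc j + m  ≡⟨ sym (+-suc j m) ⟩
    j + suc m  ≤⟨ +-monoʳ-≤ j m<n ⟩
    j + n      ≡⟨ +-comm j n ⟩
    n + j      ∎)))
    where open ≤-Reasoning

  j-not-on-arc : ¬ OnArc n i m (suc j)
  j-not-on-arc (inj₂ j<wrap) = <-asym i<j (<-≤-trans j<wrap (wrap≤start i (<⇒≤ m<n)))
  j-not-on-arc (inj₁ (_ , j<i+m)) =
    pred-not-on-arc (along eq (<-trans (n<1+n j) j<n) (inj₁ (s≤s⁻¹ i<j , <-trans (n<1+n j) j<i+m)))

arc-injectiveˡ : ∀ {n i j m} → i < n → j < n → 0 < m → m < n → arc {n} i m ≡ arc j m → i ≡ j
arc-injectiveˡ {i = i} {j} i<n j<n 0<m m<n eq with <-cmp i j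
... | tri< i<j _ _ = contradiction eq (arc-distinct i<j j<n 0<m m<n)
... | tri≈ _ i≡j _ = i≡j
... | tri> _ _ j<i = contradiction (sym eq) (arc-distinct j<i i<n 0<m m<n)

fromList : ∀ {n} → List (Subset n) → Family n
fromList L s = does (any? (≡-dec Bool._≟_ s) L)

∈fromList⁺ : ∀ {n} {s : Subset n} {L} → s ∈ₗ L → s ∈F fromList L
∈fromList⁺ {s = s} {L} = dec-true (any? (≡-dec Bool._≟_ s) L)

∈fromList⁻ : ∀ {n} {s : Subset n} {L} → s ∈F fromList L → s ∈ₗ L
∈fromList⁻ {s = s} {L} with any? (≡-dec Bool._≟_ s) L
... | yes s∈L = λ _ → s∈L
... | no  _   = λ ()

column : ∀ {n} → Bool → List (Subset (suc n)) → List (Subset n)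
column b     []                = []
column false ((false ∷ t) ∷ L) = t ∷ column false L
column false ((true  ∷ _) ∷ L) = column false L
column true  ((false ∷ _) ∷ L) = column true L
column true  ((true  ∷ t) ∷ L) = t ∷ column true L

length-columns : ∀ {n} (L : List (Subset (suc n))) →
  length (column false L) + length (column true L) ≡ length L
length-columns []                = refl
length-columns ((false ∷ _) ∷ L) = cong suc (length-columns L)
length-columns ((true  ∷ _) ∷ L) = trans (+-suc _ _) (cong suc (length-columns L))

∈-column : ∀ {n} b {t : Subset n} L → (b ∷ t) ∈ₗ L → t ∈ₗ column b L
∈-column false ((false ∷ _) ∷ L) (here refl) = here refl
∈-column true  ((true  ∷ _) ∷ L) (here refl) = here refl
∈-column false ((false ∷ _) ∷ L) (there p)   = there (∈-column false L p)
∈-column false ((true  ∷ _) ∷ L) (there p)   = ∈-column false L p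
∈-column true  ((false ∷ _) ∷ L) (there p)   = ∈-column true L p
∈-column true  ((true  ∷ _) ∷ L) (there p)   = there (∈-column true L p)

size≤length : ∀ {n} (F : Family n) (L : List (Subset n)) →
  (∀ {s} → s ∈F F → s ∈ₗ L) → size F ≤ length L
size≤length {zero} F L F⊆L with F [] in []∈F
... | false = z≤n
... | true  with F⊆L []∈F
...   | here _  = s≤s z≤n
...   | there _ = s≤s z≤n
size≤length {suc n} F L F⊆L = begin
  size (λ s → F (false ∷ s)) + size (λ s → F (true ∷ s))
    ≤⟨ +-mono-≤ (size≤length _ (column false L) (∈-column false L ∘ F⊆L))
                (size≤length _ (column true L) (∈-column true L ∘ F⊆L)) ⟩
  length (column false L) + length (column true L)
    ≡⟨ length-columns L ⟩
  length L ∎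
  where open ≤-Reasoning

length-cartesianProductWith : ∀ {A B C : Set} (f : A → B → C) (xs : List A) (ys : List B) →
  length (cartesianProductWith f xs ys) ≡ length xs * length ys
length-cartesianProductWith f []       ys = refl
length-cartesianProductWith f (x ∷ xs) ys = begin
  length (map (f x) ys ++ cartesianProductWith f xs ys)         ≡⟨ length-++ (map (f x) ys) ⟩
  length (map (f x) ys) + length (cartesianProductWith f xs ys) ≡⟨ cong₂ _+_ (length-map (f x) ys)
                                                                         (length-cartesianProductWith f xs ys) ⟩
  length ys + length xs * length ys                             ∎
  where open ≡-Reasoning

InducedSubposet : Poset → Poset → Set
InducedSubposet P Q =
  Σ (P.Carrier → Q.Carrier) λ ι → Injective _≡_ _≡_ ι × (∀ u v → (u P.≤P v) ⇔ (ι u Q.≤P ι v))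
  where module P = Poset P
        module Q = Poset Q

restrict : ∀ {n} {P Q : Poset} {F : Family n} →
  InducedSubposet P Q → HasInducedCopy Q F → HasInducedCopy P F
restrict (ι , ι-inj , ι-rel) (f , f-inj , f∈F , f-rel) =
  f ∘ ι , ι-inj ∘ f-inj , f∈F ∘ ι , λ u v → f-rel (ι u) (ι v) ⇔-∘ ι-rel u v

embedding⇒copy : ∀ {n} (P : Poset) (F : Family n) → Antisymmetric _≡_ (Poset._≤P_ P) →
  (f : Poset.Carrier P → Subset n) → (∀ u → f u ∈F F) →
  (∀ u v → Poset._≤P_ P u v ⇔ (f u ⊆ f v)) → HasInducedCopy P F
embedding⇒copy P F antisym f f∈F f-rel = f , injective , f∈F , f-rel
  where
  injective : Injective _≡_ _≡_ f
  injective {u} {v} fu≡fv = antisym (Equivalence.from (f-rel u v) (⊆-reflexive fu≡fv))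
                                    (Equivalence.from (f-rel v u) (⊆-reflexive (sym fu≡fv)))

𝒜⊑𝒱 : ∀ k → InducedSubposet (𝒜 k) (𝒱 k)
𝒜⊑𝒱 k = just , just-injective , λ _ _ → mk⇔ id id

𝒜⊑Λ : ∀ k → InducedSubposet (𝒜 k) (Λ k)
𝒜⊑Λ k = just , just-injective , λ _ _ → mk⇔ id id

𝒜⊑𝒟 : ∀ k → InducedSubposet (𝒜 k) (𝒟 k)
𝒜⊑𝒟 k = mid , (λ { refl → refl }) , λ _ _ → mk⇔ id id

𝒱-antisym : ∀ k → Antisymmetric _≡_ (vRel k)
𝒱-antisym k {nothing} {nothing} _   _ = refl
𝒱-antisym k {just i}  {just j}  i≡j _ = cong just i≡j

Λ-antisym : ∀ k → Antisymmetric _≡_ (λRel k)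
Λ-antisym k {nothing} {nothing} _   _ = refl
Λ-antisym k {just i}  {just j}  i≡j _ = cong just i≡j

𝒟-antisym : ∀ k → Antisymmetric _≡_ (dRel k)
𝒟-antisym k {bot}   {bot}   _   _ = refl
𝒟-antisym k {top}   {top}   _   _ = refl
𝒟-antisym k {mid i} {mid j} i≡j _ = cong mid i≡j

module ArcChains (n k : ℕ) (1≤k : 1 ≤ k) (k<n : k < n) where

  chainArc : Fin k → ℕ → Subset n
  chainArc i m = arc (toℕ i) m

  arcList : List (Subset n)
  arcList = ⊥ ∷ ⊤ ∷ cartesianProductWith chainArc (allFin k) (applyUpTo suc (n ∸ 1))

  arcFamily : Family n
  arcFamily = fromList arcList

  size-arcFamily : size arcFamily ≤ k * (n ∸ 1) + 2
  size-arcFamily = begin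
    size arcFamily  ≤⟨ size≤length arcFamily arcList ∈fromList⁻ ⟩
    length arcList  ≡⟨ cong (2 +_) (trans
                         (length-cartesianProductWith chainArc (allFin k) (applyUpTo suc (n ∸ 1)))
                         (cong₂ _*_ (length-tabulate {n = k} id) (length-applyUpTo suc (n ∸ 1)))) ⟩
    2 + k * (n ∸ 1) ≡⟨ +-comm 2 (k * (n ∸ 1)) ⟩
    k * (n ∸ 1) + 2 ∎
    where open ≤-Reasoning

  chain-index<n : (i : Fin k) → toℕ i < n
  chain-index<n i = <-trans (Fin.toℕ<n i) k<n

  firstChain : Fin k
  firstChain = fromℕ< 1≤k

  chainArc∈arcFamily : ∀ (i : Fin k) {m} → 0 < m → m < n → chainArc i m ∈F arcFamily
  chainArc∈arcFamily i {suc m} _ m<n = ∈fromList⁺ (there (there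
    (∈-cartesianProductWith⁺ chainArc (∈-allFin i) (∈-applyUpTo⁺ suc (∸-monoˡ-< m<n (s≤s z≤n))))))

  ⊥∈arcFamily : ⊥ ∈F arcFamily
  ⊥∈arcFamily = ∈fromList⁺ {L = arcList} (here refl)

  ⊤∈arcFamily : ⊤ ∈F arcFamily
  ⊤∈arcFamily = ∈fromList⁺ {L = arcList} (there (here refl))

  ∈arcFamily⇒onChain : ∀ s → s ∈F arcFamily → Σ (Fin k) λ i → Σ ℕ λ m → s ≡ chainArc i m
  ∈arcFamily⇒onChain s s∈F with ∈fromList⁻ {s = s} {L = arcList} s∈F
  ... | here refl         = firstChain , 0 , sym (arc-empty _ (<⇒≤ (chain-index<n firstChain)))
  ... | there (here refl) = firstChain , n , sym (arc-full _ (<⇒≤ (chain-index<n firstChain)))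
  ... | there (there p)
    with i , m , _ , _ , refl ← ∈-cartesianProductWith⁻ chainArc (allFin k) _ p = i , m , refl

  chainOf : ∀ s → s ∈F arcFamily → Fin k
  chainOf s = proj₁ ∘ ∈arcFamily⇒onChain s

  sameChain⇒comparable : ∀ s t (s∈F : s ∈F arcFamily) (t∈F : t ∈F arcFamily) →
    chainOf s s∈F ≡ chainOf t t∈F → s ⊆ t ⊎ t ⊆ s
  sameChain⇒comparable s t s∈F t∈F same
    with ∈arcFamily⇒onChain s s∈F | ∈arcFamily⇒onChain t t∈F | same
  ... | i , m , refl | .i , m′ , refl | refl = Sum.map (arc-mono (toℕ i)) (arc-mono (toℕ i)) (≤-total m m′)

  arcFamily-noAntichain : (h : Fin (suc k) → Subset n) → (∀ j → h j ∈F arcFamily) →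
    ¬ (∀ j j′ → h j ⊆ h j′ → j ≡ j′)
  arcFamily-noAntichain h h∈F antichain
    with a , b , a<b , same ← pigeonhole ≤-refl (λ j → chainOf (h j) (h∈F j)) =
    Fin.<⇒≢ a<b (Sum.[ antichain a b , sym ∘ antichain b a ]
                      (sameChain⇒comparable (h a) (h b) (h∈F a) (h∈F b) same))

  arcFamily-no𝒜 : ¬ HasInducedCopy (𝒜 k) arcFamily
  arcFamily-no𝒜 (f , _ , f∈F , f-rel) = arcFamily-noAntichain f f∈F (λ j j′ → Equivalence.from (f-rel j j′))

  module Saturation (F′ : Family n) (F⊆F′ : ∀ s → s ∈F arcFamily → s ∈F F′)
                    (s : Subset n) (s∈F′ : s ∈F F′) (s∉F : ¬ s ∈F arcFamily) where

    m : ℕ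
    m = ∣ s ∣

    0<m : 0 < m
    0<m = n≢0⇒n>0 λ m≡0 →
      s∉F (subst (_∈F arcFamily) (sym (∣p∣≡0⇒p≡⊥ {p = s} m≡0)) ⊥∈arcFamily)

    m<n : m < n
    m<n = ≤∧≢⇒< (∣p∣≤n s) λ m≡n →
      s∉F (subst (_∈F arcFamily) (sym (∣p∣≡n⇒p≡⊤ {p = s} m≡n)) ⊤∈arcFamily)

    antichain : Fin (suc k) → Subset n
    antichain zero    = s
    antichain (suc i) = chainArc i m

    ∣antichain∣ : ∀ j → ∣ antichain j ∣ ≡ m
    ∣antichain∣ zero    = refl
    ∣antichain∣ (suc i) = ∣arc∣ (toℕ i) m (<⇒≤ (chain-index<n i)) (<⇒≤ m<n)

    antichain∈F′ : ∀ j → antichain j ∈F F′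
    antichain∈F′ zero    = s∈F′
    antichain∈F′ (suc i) = F⊆F′ (chainArc i m) (chainArc∈arcFamily i 0<m m<n)

    antichain-injective : Injective _≡_ _≡_ antichain
    antichain-injective {zero}  {zero}  _   = refl
    antichain-injective {zero}  {suc i} s≡a =
      contradiction (subst (_∈F arcFamily) (sym s≡a) (chainArc∈arcFamily i 0<m m<n)) s∉F
    antichain-injective {suc i} {zero}  a≡s =
      contradiction (subst (_∈F arcFamily) a≡s (chainArc∈arcFamily i 0<m m<n)) s∉F
    antichain-injective {suc i} {suc j} a≡a =
      cong suc (toℕ-injective (arc-injectiveˡ (chain-index<n i) (chain-index<n j) 0<m m<n a≡a))

    antichain-⊆⇒≡ : ∀ j j′ → antichain j ⊆ antichain j′ → j ≡ j′
    antichain-⊆⇒≡ j j′ j⊆j′ = antichain-injective (⊆∧∣≡∣⇒≡ j⊆j′ (trans (∣antichain∣ j) (sym (∣antichain∣ j′))))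

    antichain-rel : ∀ j j′ → (j ≡ j′) ⇔ (antichain j ⊆ antichain j′)
    antichain-rel j j′ = mk⇔ (λ { refl → ⊆-refl }) (antichain-⊆⇒≡ j j′)

    antichain⊈⊥ : ∀ j → ¬ antichain j ⊆ ⊥
    antichain⊈⊥ j j⊆⊥ = <⇒≱ 0<m (subst₂ _≤_ (∣antichain∣ j) (∣⊥∣≡0 n) (p⊆q⇒∣p∣≤∣q∣ j⊆⊥))

    ⊤⊈antichain : ∀ j → ¬ ⊤ ⊆ antichain j
    ⊤⊈antichain j ⊤⊆j = <⇒≱ m<n (subst₂ _≤_ (∣⊤∣≡n n) (∣antichain∣ j) (p⊆q⇒∣p∣≤∣q∣ ⊤⊆j))

    ⊤⊈⊥ : ¬ ⊤ ⊆ ⊥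
    ⊤⊈⊥ ⊤⊆⊥ = ⊤⊈antichain zero (⊥⊆ ∘ ⊤⊆⊥)

    ⊥∈F′ : ⊥ ∈F F′
    ⊥∈F′ = F⊆F′ ⊥ ⊥∈arcFamily

    ⊤∈F′ : ⊤ ∈F F′
    ⊤∈F′ = F⊆F′ ⊤ ⊤∈arcFamily

    copy𝒜 : HasInducedCopy (𝒜 k) F′
    copy𝒜 = antichain , antichain-injective , antichain∈F′ , antichain-rel

    copy𝒱 : HasInducedCopy (𝒱 k) F′
    copy𝒱 = embedding⇒copy (𝒱 k) F′ (𝒱-antisym k) f f∈F′ f-rel
      where
      f : Maybe (Fin (suc k)) → Subset n
      f nothing  = ⊥
      f (just j) = antichain j
      f∈F′ : ∀ u → f u ∈F F′
      f∈F′ nothing  = ⊥∈F′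
      f∈F′ (just j) = antichain∈F′ j
      f-rel : ∀ u v → vRel k u v ⇔ (f u ⊆ f v)
      f-rel nothing  _        = mk⇔ (λ _ {x} → ⊥⊆ {x = x}) (λ _ → tt)
      f-rel (just i) nothing  = mk⇔ (λ ()) (antichain⊈⊥ i)
      f-rel (just i) (just j) = antichain-rel i j

    copyΛ : HasInducedCopy (Λ k) F′
    copyΛ = embedding⇒copy (Λ k) F′ (Λ-antisym k) f f∈F′ f-rel
      where
      f : Maybe (Fin (suc k)) → Subset n
      f nothing  = ⊤
      f (just j) = antichain j
      f∈F′ : ∀ u → f u ∈F F′
      f∈F′ nothing  = ⊤∈F′
      f∈F′ (just j) = antichain∈F′ j
      f-rel : ∀ u v → λRel k u v ⇔ (f u ⊆ f v)
      f-rel _        nothing  = mk⇔ (λ _ {x} → ⊆⊤ {x = x}) (λ _ → tt)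
      f-rel nothing  (just j) = mk⇔ (λ ()) (⊤⊈antichain j)
      f-rel (just i) (just j) = antichain-rel i j

    copy𝒟 : HasInducedCopy (𝒟 k) F′
    copy𝒟 = embedding⇒copy (𝒟 k) F′ (𝒟-antisym k) f f∈F′ f-rel
      where
      f : DPt k → Subset n
      f bot     = ⊥
      f top     = ⊤
      f (mid j) = antichain j
      f∈F′ : ∀ u → f u ∈F F′
      f∈F′ bot     = ⊥∈F′
      f∈F′ top     = ⊤∈F′
      f∈F′ (mid j) = antichain∈F′ j
      f-rel : ∀ u v → dRel k u v ⇔ (f u ⊆ f v)
      f-rel bot     _       = mk⇔ (λ _ {x} → ⊥⊆ {x = x}) (λ _ → tt)
      f-rel top     bot     = mk⇔ (λ ()) ⊤⊈⊥
      f-rel top     top     = mk⇔ (λ _ {x} → id) (λ _ → tt)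
      f-rel top     (mid j) = mk⇔ (λ ()) (⊤⊈antichain j)
      f-rel (mid i) bot     = mk⇔ (λ ()) (antichain⊈⊥ i)
      f-rel (mid i) top     = mk⇔ (λ _ {x} → ⊆⊤ {x = x}) (λ _ → tt)
      f-rel (mid i) (mid j) = antichain-rel i j

proposition10 : (n k : ℕ) → 1 ≤ k → k < n → (P : Poset) →
    (P ≡ 𝒜 k ⊎ P ≡ 𝒱 k ⊎ P ≡ Λ k ⊎ P ≡ 𝒟 k) →
    Σ (Family n) (λ F → InducedSaturated P F × size F ≤ k * (n ∸ 1) + 2)
proposition10 n k 1≤k k<n P P-shape =
  arcFamily , (copy-free P-shape , saturating P-shape) , size-arcFamily
  where
  open ArcChains n k 1≤k k<n

  copy-free : (P ≡ 𝒜 k ⊎ P ≡ 𝒱 k ⊎ P ≡ Λ k ⊎ P ≡ 𝒟 k) → ¬ HasInducedCopy P arcFamily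
  copy-free (inj₁ refl)               = arcFamily-no𝒜
  copy-free (inj₂ (inj₁ refl))        = arcFamily-no𝒜 ∘ restrict {F = arcFamily} (𝒜⊑𝒱 k)
  copy-free (inj₂ (inj₂ (inj₁ refl))) = arcFamily-no𝒜 ∘ restrict {F = arcFamily} (𝒜⊑Λ k)
  copy-free (inj₂ (inj₂ (inj₂ refl))) = arcFamily-no𝒜 ∘ restrict {F = arcFamily} (𝒜⊑𝒟 k)

  saturating : (P ≡ 𝒜 k ⊎ P ≡ 𝒱 k ⊎ P ≡ Λ k ⊎ P ≡ 𝒟 k) → ∀ F′ → (∀ s → s ∈F arcFamily → s ∈F F′) →
    Σ (Subset n) (λ s → s ∈F F′ × ¬ s ∈F arcFamily) → HasInducedCopy P F′
  saturating (inj₁ refl)               F′ F⊆F′ (s , s∈F′ , s∉F) = Saturation.copy𝒜 F′ F⊆F′ s s∈F′ s∉F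
  saturating (inj₂ (inj₁ refl))        F′ F⊆F′ (s , s∈F′ , s∉F) = Saturation.copy𝒱 F′ F⊆F′ s s∈F′ s∉F
  saturating (inj₂ (inj₂ (inj₁ refl))) F′ F⊆F′ (s , s∈F′ , s∉F) = Saturation.copyΛ F′ F⊆F′ s s∈F′ s∉F
  saturating (inj₂ (inj₂ (inj₂ refl))) F′ F⊆F′ (s , s∈F′ , s∉F) = Saturation.copy𝒟 F′ F⊆F′ s s∈F′ s∉F
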